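{- Let $T_1\subset T_2\subset T_3\subset A\times B\times C$ (supports of $\{0,1\}$-valued tensors). Then $\mathrm{cc}(T_1,T_3)\le\mathrm{cc}(T_1,T_2)+\mathrm{cc}(T_2,T_3)$.
   Context: For $I\subset P\subset A\times B\times C$, the promise problem $(I,P)$: three players receive $a,b,c$ with $(a,b,c)\in P$ and must decide whether $(a,b,c)\in I$. $\mathrm{cc}(I,P)$ is deterministic communication complexity in the shared-blackboard model (players in cyclic order append bits depending on own input and the board, or accept/reject; input accepted iff all accept; correctness required only on $P$; cost = maximum number of bits written). -}

module Defs where

open import Data.Bool using (Bool; true; false; if_then_else_; _∧_)
open import Data.Nat using (ℕ; zero; suc; _⊔_; _≤_)
open import Data.Product using (Σ; _×_)
open import Relation.Binary.PropositionalEquality using (_≡_)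

Rel3 : Set → Set → Set → Set₁
Rel3 A B C = A → B → C → Set

_⊆₃_ : {A B C : Set} → Rel3 A B C → Rel3 A B C → Set
_⊆₃_ {A} {B} {C} S T = (a : A) (b : B) (c : C) → S a b c → T a b c

-- Deterministic 3-player shared-blackboard protocol, as a protocol tree.
-- Each internal node is labelled by the player who writes the next bit
-- (a function of that player's own input; the board = the path so far).
-- At a leaf (end of communication) each player accepts/rejects as a
-- function of its own input (and of the board, i.e. the leaf).
data Protocol (A B C : Set) : Set where
  leaf : (A → Bool) → (B → Bool) → (C → Bool) → Protocol A B C
  sayA : (A → Bool) → Protocol A B C → Protocol A B C → Protocol A B C
  sayB : (B → Bool) → Protocol A B C → Protocol A B C → Protocol A B C
  sayC : (C → Bool) → Protocol A B C → Protocol A B C → Protocol A B C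

accepts : {A B C : Set} → Protocol A B C → A → B → C → Bool
accepts (leaf fa fb fc) a b c = fa a ∧ fb b ∧ fc c
accepts (sayA f p₀ p₁) a b c = if f a then accepts p₁ a b c else accepts p₀ a b c
accepts (sayB f p₀ p₁) a b c = if f b then accepts p₁ a b c else accepts p₀ a b c
accepts (sayC f p₀ p₁) a b c = if f c then accepts p₁ a b c else accepts p₀ a b c

cost : {A B C : Set} → Protocol A B C → ℕ
cost (leaf _ _ _) = zero
cost (sayA _ p₀ p₁) = suc (cost p₀ ⊔ cost p₁)
cost (sayB _ p₀ p₁) = suc (cost p₀ ⊔ cost p₁)
cost (sayC _ p₀ p₁) = suc (cost p₀ ⊔ cost p₁)

-- π solves the promise problem (I, P): correct on every input in P.
Solves : {A B C : Set} → Rel3 A B C → Rel3 A B C → Protocol A B C → Set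
Solves {A} {B} {C} I P π =
  (a : A) (b : B) (c : C) → P a b c →
  ((accepts π a b c ≡ true → I a b c) × (I a b c → accepts π a b c ≡ true))

-- cc(I,P) ≤ k : some protocol of cost ≤ k solves (I,P).
-- (cc(I,P) is the least such k, so cc(I,P) ≤ cc(I',P') + cc(I'',P'')
--  is exactly the implication stated.)
CC≤ : {A B C : Set} → Rel3 A B C → Rel3 A B C → ℕ → Set
CC≤ {A} {B} {C} I P k = Σ (Protocol A B C) (λ π → (cost π ≤ k) × Solves I P π)

-- Run a protocol for (T₁,T₂) and then one for (T₂,T₃), accepting iff both accept.
-- On T₃ the second run decides membership in T₂; inside T₂ the first run decides
-- membership in T₁, and outside T₂ its answer is irrelevant because the second
-- run rejects. Since T₁ ⊆ T₂ the conjunction therefore decides T₁ on T₃, and the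
-- sequential composition costs exactly the sum of the two costs.
module Submission where

open import Defs
open import Data.Bool using (Bool; true; _∧_)
open import Data.Bool.Properties using (∧-commutativeMonoid; ∧-conicalˡ; ∧-conicalʳ; if-float)
open import Data.Nat using (ℕ; _+_; _⊔_; suc)
open import Data.Nat.Properties using (+-distribʳ-⊔; +-mono-≤; ≤-trans; ≤-reflexive)
open import Data.Product using (_,_; proj₁; proj₂)
open import Algebra.Bundles using (CommutativeMonoid)
open import Algebra.Properties.CommutativeSemigroup
  (CommutativeMonoid.commutativeSemigroup ∧-commutativeMonoid) using (interchange)
open import Relation.Binary.PropositionalEquality using (_≡_; refl; sym; trans; cong; cong₂)
open Relation.Binary.PropositionalEquality.≡-Reasoning

suc-⊔-distribʳ-+ : ∀ {x y} m n k → x ≡ m + k → y ≡ n + k → suc (x ⊔ y) ≡ suc (m ⊔ n) + k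
suc-⊔-distribʳ-+ m n k refl refl = cong suc (sym (+-distribʳ-⊔ k m n))

module _ {A B C : Set} where

  -- Each player conjoins its own verdict g with every final verdict of the protocol:
  -- this is how a verdict from an earlier protocol is kept without writing it on the board.
  guard : (A → Bool) → (B → Bool) → (C → Bool) → Protocol A B C → Protocol A B C
  guard ga gb gc (leaf fa fb fc) = leaf (λ a → ga a ∧ fa a) (λ b → gb b ∧ fb b) (λ c → gc c ∧ fc c)
  guard ga gb gc (sayA f p q) = sayA f (guard ga gb gc p) (guard ga gb gc q)
  guard ga gb gc (sayB f p q) = sayB f (guard ga gb gc p) (guard ga gb gc q)
  guard ga gb gc (sayC f p q) = sayC f (guard ga gb gc p) (guard ga gb gc q)

  infixr 5 _▹_

  _▹_ : Protocol A B C → Protocol A B C → Protocol A B C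
  leaf fa fb fc ▹ ρ = guard fa fb fc ρ
  sayA f p q    ▹ ρ = sayA f (p ▹ ρ) (q ▹ ρ)
  sayB f p q    ▹ ρ = sayB f (p ▹ ρ) (q ▹ ρ)
  sayC f p q    ▹ ρ = sayC f (p ▹ ρ) (q ▹ ρ)

  accepts-guard : ∀ ga gb gc π a b c →
    accepts (guard ga gb gc π) a b c ≡ accepts (leaf ga gb gc) a b c ∧ accepts π a b c
  accepts-guard ga gb gc (leaf fa fb fc) a b c = begin
    (ga a ∧ fa a) ∧ (gb b ∧ fb b) ∧ (gc c ∧ fc c)
      ≡⟨ cong ((ga a ∧ fa a) ∧_) (interchange (gb b) (fb b) (gc c) (fc c)) ⟩
    (ga a ∧ fa a) ∧ (gb b ∧ gc c) ∧ (fb b ∧ fc c)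
      ≡⟨ interchange (ga a) (fa a) (gb b ∧ gc c) (fb b ∧ fc c) ⟩
    (ga a ∧ gb b ∧ gc c) ∧ (fa a ∧ fb b ∧ fc c) ∎
  accepts-guard ga gb gc (sayA f p q) a b c
    rewrite accepts-guard ga gb gc p a b c | accepts-guard ga gb gc q a b c =
      sym (if-float ((ga a ∧ gb b ∧ gc c) ∧_) (f a))
  accepts-guard ga gb gc (sayB f p q) a b c
    rewrite accepts-guard ga gb gc p a b c | accepts-guard ga gb gc q a b c =
      sym (if-float ((ga a ∧ gb b ∧ gc c) ∧_) (f b))
  accepts-guard ga gb gc (sayC f p q) a b c
    rewrite accepts-guard ga gb gc p a b c | accepts-guard ga gb gc q a b c =
      sym (if-float ((ga a ∧ gb b ∧ gc c) ∧_) (f c))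

  accepts-▹ : ∀ π ρ a b c → accepts (π ▹ ρ) a b c ≡ accepts π a b c ∧ accepts ρ a b c
  accepts-▹ (leaf fa fb fc) ρ a b c = accepts-guard fa fb fc ρ a b c
  accepts-▹ (sayA f p q) ρ a b c
    rewrite accepts-▹ p ρ a b c | accepts-▹ q ρ a b c = sym (if-float (_∧ accepts ρ a b c) (f a))
  accepts-▹ (sayB f p q) ρ a b c
    rewrite accepts-▹ p ρ a b c | accepts-▹ q ρ a b c = sym (if-float (_∧ accepts ρ a b c) (f b))
  accepts-▹ (sayC f p q) ρ a b c
    rewrite accepts-▹ p ρ a b c | accepts-▹ q ρ a b c = sym (if-float (_∧ accepts ρ a b c) (f c))

  cost-guard : ∀ ga gb gc π → cost (guard ga gb gc π) ≡ cost π
  cost-guard ga gb gc (leaf _ _ _) = refl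
  cost-guard ga gb gc (sayA f p q) = cong₂ (λ m n → suc (m ⊔ n)) (cost-guard ga gb gc p) (cost-guard ga gb gc q)
  cost-guard ga gb gc (sayB f p q) = cong₂ (λ m n → suc (m ⊔ n)) (cost-guard ga gb gc p) (cost-guard ga gb gc q)
  cost-guard ga gb gc (sayC f p q) = cong₂ (λ m n → suc (m ⊔ n)) (cost-guard ga gb gc p) (cost-guard ga gb gc q)

  cost-▹ : ∀ π ρ → cost (π ▹ ρ) ≡ cost π + cost ρ
  cost-▹ (leaf fa fb fc) ρ = cost-guard fa fb fc ρ
  cost-▹ (sayA f p q) ρ = suc-⊔-distribʳ-+ (cost p) (cost q) (cost ρ) (cost-▹ p ρ) (cost-▹ q ρ)
  cost-▹ (sayB f p q) ρ = suc-⊔-distribʳ-+ (cost p) (cost q) (cost ρ) (cost-▹ p ρ) (cost-▹ q ρ)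
  cost-▹ (sayC f p q) ρ = suc-⊔-distribʳ-+ (cost p) (cost q) (cost ρ) (cost-▹ p ρ) (cost-▹ q ρ)

  solves-▹ : {I₁ I₂ P : Rel3 A B C} (π ρ : Protocol A B C) →
    I₁ ⊆₃ I₂ → Solves I₁ I₂ π → Solves I₂ P ρ → Solves I₁ P (π ▹ ρ)
  solves-▹ {I₁} {I₂} π ρ I₁⊆I₂ π-solves ρ-solves a b c p = sound , complete
    where
    accepts-both : accepts (π ▹ ρ) a b c ≡ accepts π a b c ∧ accepts ρ a b c
    accepts-both = accepts-▹ π ρ a b c

    sound : accepts (π ▹ ρ) a b c ≡ true → I₁ a b c
    sound acc = proj₁ (π-solves a b c i₂) (∧-conicalˡ _ _ both)
      where
      both : accepts π a b c ∧ accepts ρ a b c ≡ true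
      both = trans (sym accepts-both) acc
      i₂ : I₂ a b c
      i₂ = proj₁ (ρ-solves a b c p) (∧-conicalʳ _ _ both)

    complete : I₁ a b c → accepts (π ▹ ρ) a b c ≡ true
    complete i₁ = trans accepts-both (cong₂ _∧_ (proj₂ (π-solves a b c i₂) i₁)
                                                (proj₂ (ρ-solves a b c p) i₂))
      where
      i₂ : I₂ a b c
      i₂ = I₁⊆I₂ a b c i₁

  CC≤-▹ : {I₁ I₂ P : Rel3 A B C} {k₁ k₂ : ℕ} →
    I₁ ⊆₃ I₂ → CC≤ I₁ I₂ k₁ → CC≤ I₂ P k₂ → CC≤ I₁ P (k₁ + k₂)
  CC≤-▹ I₁⊆I₂ (π , cost-π≤k₁ , π-solves) (ρ , cost-ρ≤k₂ , ρ-solves) =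
    π ▹ ρ ,
    ≤-trans (≤-reflexive (cost-▹ π ρ)) (+-mono-≤ cost-π≤k₁ cost-ρ≤k₂) ,
    solves-▹ π ρ I₁⊆I₂ π-solves ρ-solves

mainTheorem17 : {A B C : Set} (T₁ T₂ T₃ : Rel3 A B C) →
    T₁ ⊆₃ T₂ → T₂ ⊆₃ T₃ →
    (k₁ k₂ : ℕ) → CC≤ T₁ T₂ k₁ → CC≤ T₂ T₃ k₂ → CC≤ T₁ T₃ (k₁ + k₂)
mainTheorem17 T₁ T₂ T₃ T₁⊆T₂ _ k₁ k₂ = CC≤-▹ T₁⊆T₂
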